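{- For every integer $k\geq 4$ and every integer $n\ge k$, $r(B^{(k)},K^{(k)}_n) \leq (n!)^{k-1}$.
   Context: A $k$-half-graph $B^{(k)}$ is the $k$-uniform hypergraph on $2k-2$ vertices with vertex set $S\cup T$, $S\cap T=\emptyset$, $|S|=|T|=k-1$, whose edges are all $k$-subsets of $S\cup T$ containing $S$ (i.e. $S\cup\{v\}$ for $v\in T$), together with one $k$-subset containing $T$ (i.e. $T\cup\{u\}$ for one $u\in S$). $K^{(k)}_n$ is the complete $k$-uniform hypergraph on $n$ vertices. $r(B^{(k)},K^{(k)}_n)$ is the minimum $N$ such that every red-blue coloring of the $k$-subsets of an $N$-element set contains a red copy of $B^{(k)}$ or a blue copy of $K^{(k)}_n$. -}

module Defs where

open import Data.Nat using (ℕ; _≤_; _∸_)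
open import Data.Bool using (Bool; true; false)
open import Data.Fin using (Fin)
open import Data.Fin.Subset using (Subset; _∈_; _∉_; _⊆_; _∪_; ⁅_⁆; ∣_∣)
open import Data.Product using (Σ; ∃; _×_)
open import Data.Sum using (_⊎_)
open import Relation.Binary.PropositionalEquality using (_≡_)

-- A red/blue colouring of the k-subsets of Fin N.  For convenience it is
-- given on all subsets; only its values on k-subsets are ever used.
-- Convention: true = red, false = blue.
Colouring : ℕ → Set
Colouring N = Subset N → Bool

red blue : Bool
red = true
blue = false

-- A red copy of the k-half-graph B^(k) in colouring c:
-- disjoint S, T ⊆ Fin N with |S| = |T| = k-1, every S ∪ {v} (v ∈ T) red,
-- and T ∪ {u} red for at least one u ∈ S.
RedHalfGraph : (k N : ℕ) → Colouring N → Set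
RedHalfGraph k N c =
  Σ (Subset N) λ S → Σ (Subset N) λ T →
    (∀ x → x ∈ S → x ∉ T) ×
    ∣ S ∣ ≡ k ∸ 1 × ∣ T ∣ ≡ k ∸ 1 ×
    (∀ v → v ∈ T → c (S ∪ ⁅ v ⁆) ≡ red) ×
    (Σ (Fin N) λ u → u ∈ S × c (T ∪ ⁅ u ⁆) ≡ red)

BlueClique : (k n N : ℕ) → Colouring N → Set
BlueClique k n N c =
  Σ (Subset N) λ A → ∣ A ∣ ≡ n ×
    (∀ s → s ⊆ A → ∣ s ∣ ≡ k → c s ≡ blue)

Arrows : (k n N : ℕ) → Set
Arrows k n N = (c : Colouring N) → RedHalfGraph k N c ⊎ BlueClique k n N c

-- r(B^(k), K^(k)_n) ≤ M  (r is the least N with Arrows k n N).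
RamseyHalfGraph≤ : (k n M : ℕ) → Set
RamseyHalfGraph≤ k n M = ∃ λ N → N ≤ M × Arrows k n N

-- Induction on m: every W with ∣W∣ ≥ (m!)^e, e = k − 1 ≥ 2, contains a red
-- half-graph or a blue m-clique.  Take a blue m-clique K ⊆ W and, for each
-- e-subset Q ⊆ K, the set Y_Q of v ∈ W ∖ K with Q ∪ {v} red.  If some
-- ∣Y_Q∣ ≥ (m!)^e, a blue m-clique K' ⊆ Y_Q plus any u ∈ Q is either a blue
-- (m+1)-clique, or has a red edge T ∪ {u}, and then (Q, T) is a red half-graph.
-- Otherwise the Y_Q cover at most m^e (m!)^e vertices, while
-- ∣W∣ ≥ ((m+1)!)^e > m + m^e (m!)^e, so some v ∈ W ∖ K lies in no Y_Q and
-- K ∪ {v} is a blue (m+1)-clique.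
module Submission where

open import Defs
open import Data.Nat using (ℕ; zero; suc; _+_; _*_; _∸_; _^_; _≤_; _<_; _≤?_; z≤n; s≤s; _!)
open import Data.Nat.Properties
open import Data.Bool using (true; false)
import Data.Bool as Bool
open import Data.Fin using (Fin; zero; suc)
open import Data.Fin.Subset
open import Data.Fin.Subset.Properties
open import Data.Vec using ([]; _∷_; here; there; tabulate)
open import Data.Vec.Properties using ([]=⇒lookup; lookup⇒[]=; lookup∘tabulate)
open import Data.List using (List; []; _∷_; [_]; map; _++_; length)
open import Data.List.Properties using (length-map; length-++)
open import Data.List.Membership.Propositional using (find) renaming (_∈_ to _∈ₗ_)
open import Data.List.Membership.Propositional.Properties using (∈-map⁺; ∈-map⁻; ∈-++⁺ˡ; ∈-++⁺ʳ; ∈-++⁻)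
open import Data.List.Relation.Unary.Any using (here; there; any?)
open import Data.List.Relation.Unary.All using (All; []; _∷_)
import Data.List.Relation.Unary.All as All
open import Data.List.Relation.Unary.All.Properties using (¬Any⇒All¬; map⁺)
open import Data.Product using (Σ; ∃; _×_; _,_; proj₁; proj₂)
open import Data.Sum using (_⊎_; inj₁; inj₂)
open import Relation.Nullary using (yes; no; contradiction)
open import Relation.Nullary.Decidable using (_×-dec_)
open import Relation.Binary.PropositionalEquality hiding ([_])
open import Function using (_∘_)

^-distribʳ-* : ∀ m n o → (m * n) ^ o ≡ m ^ o * n ^ o
^-distribʳ-* m n zero    = refl
^-distribʳ-* m n (suc o) =
  trans (cong (m * n *_) (^-distribʳ-* m n o)) ([m*n]*[o*p]≡[m*o]*[n*p] m n (m ^ o) (n ^ o))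

1+m+m^d≤[1+m]^d : ∀ m d → 2 ≤ d → suc m + m ^ d ≤ suc m ^ d
1+m+m^d≤[1+m]^d m (suc d@(suc d′)) (s≤s (s≤s z≤n)) =
  +-mono-≤ (m≤m*n (suc m) (suc m ^ d′) {{m^n≢0 (suc m) d′}})
           (*-monoʳ-≤ m (^-monoˡ-≤ d (n≤1+n m)))

m!^e≤[1+m]!^e : ∀ m e → (m !) ^ e ≤ (suc m !) ^ e
m!^e≤[1+m]!^e m e = ^-monoˡ-≤ e (m≤n*m (m !) (suc m))

m+m^e*m!^e<[1+m]!^e : ∀ m e → 2 ≤ e → m + m ^ e * (m !) ^ e < (suc m !) ^ e
m+m^e*m!^e<[1+m]!^e m e 2≤e = begin
  suc m + m ^ e * F     ≤⟨ +-monoˡ-≤ _ (m≤m*n (suc m) F {{m^n≢0 (m !) e}}) ⟩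
  suc m * F + m ^ e * F ≡⟨ *-distribʳ-+ F (suc m) (m ^ e) ⟨
  (suc m + m ^ e) * F   ≤⟨ *-monoˡ-≤ F (1+m+m^d≤[1+m]^d m e 2≤e) ⟩
  suc m ^ e * F         ≡⟨ ^-distribʳ-* (suc m) (m !) e ⟨
  (suc m !) ^ e         ∎
  where
  open ≤-Reasoning
  instance _ = m !≢0
  F = (m !) ^ e

x∈p─q⁻ : ∀ {n} {x : Fin n} (p q : Subset n) → x ∈ p ─ q → x ∈ p × x ∉ q
x∈p─q⁻ {x = zero}  (true ∷ p) (false ∷ q) here      = here , λ ()
x∈p─q⁻ {x = suc x} (_ ∷ p)    (_ ∷ q)     (there h) with x∈p─q⁻ p q h
... | x∈p , x∉q = there x∈p , λ x∈q → x∉q (drop-there x∈q)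

x∈p-y⁻ : ∀ {n} {x y : Fin n} {p : Subset n} → x ∈ p - y → x ∈ p × x ≢ y
x∈p-y⁻ {y = y} {p} h with x∈p─q⁻ p ⁅ y ⁆ h
... | x∈p , x∉⁅y⁆ = x∈p , x∉⁅y⁆⇒x≢y x∉⁅y⁆

∣p∪q∣≤∣p∣+∣q∣ : ∀ {n} (p q : Subset n) → ∣ p ∪ q ∣ ≤ ∣ p ∣ + ∣ q ∣
∣p∪q∣≤∣p∣+∣q∣ []          []          = z≤n
∣p∪q∣≤∣p∣+∣q∣ (true ∷ p)  (s ∷ q)     = s≤s (≤-trans (∣p∪q∣≤∣p∣+∣q∣ p q) (+-monoʳ-≤ ∣ p ∣ (∣p∣≤∣x∷p∣ s q)))
∣p∪q∣≤∣p∣+∣q∣ (false ∷ p) (true ∷ q)  = subst (suc ∣ p ∪ q ∣ ≤_) (sym (+-suc ∣ p ∣ ∣ q ∣)) (s≤s (∣p∪q∣≤∣p∣+∣q∣ p q))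
∣p∪q∣≤∣p∣+∣q∣ (false ∷ p) (false ∷ q) = ∣p∪q∣≤∣p∣+∣q∣ p q

x∉p⇒∣p∪⁅x⁆∣≡1+∣p∣ : ∀ {n} {x : Fin n} {p : Subset n} → x ∉ p → ∣ p ∪ ⁅ x ⁆ ∣ ≡ suc ∣ p ∣
x∉p⇒∣p∪⁅x⁆∣≡1+∣p∣ {x = zero}  {p = true ∷ p}  x∉p = contradiction here x∉p
x∉p⇒∣p∪⁅x⁆∣≡1+∣p∣ {x = zero}  {p = false ∷ p} _   = cong (suc ∘ ∣_∣) (∪-identityʳ p)
x∉p⇒∣p∪⁅x⁆∣≡1+∣p∣ {x = suc x} {p = true ∷ p}  x∉p = cong suc (x∉p⇒∣p∪⁅x⁆∣≡1+∣p∣ (x∉p ∘ there))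
x∉p⇒∣p∪⁅x⁆∣≡1+∣p∣ {x = suc x} {p = false ∷ p} x∉p = x∉p⇒∣p∪⁅x⁆∣≡1+∣p∣ (x∉p ∘ there)

x∈p⇒p-x∪⁅x⁆≡p : ∀ {n} {x : Fin n} {p : Subset n} → x ∈ p → (p - x) ∪ ⁅ x ⁆ ≡ p
x∈p⇒p-x∪⁅x⁆≡p {x = zero}  {p = true ∷ p}  here      = cong (true ∷_) (trans (∪-identityʳ (p ─ ⊥)) (p─⊥≡p p))
x∈p⇒p-x∪⁅x⁆≡p {x = suc x} {p = true ∷ p}  (there h) = cong (true ∷_) (x∈p⇒p-x∪⁅x⁆≡p h)
x∈p⇒p-x∪⁅x⁆≡p {x = suc x} {p = false ∷ p} (there h) = cong (false ∷_) (x∈p⇒p-x∪⁅x⁆≡p h)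

x∈p⇒∣p∣≡1+∣p-x∣ : ∀ {n} {x : Fin n} {p : Subset n} → x ∈ p → ∣ p ∣ ≡ suc ∣ p - x ∣
x∈p⇒∣p∣≡1+∣p-x∣ {x = x} {p} x∈p = begin
  ∣ p ∣               ≡⟨ cong ∣_∣ (x∈p⇒p-x∪⁅x⁆≡p x∈p) ⟨
  ∣ (p - x) ∪ ⁅ x ⁆ ∣ ≡⟨ x∉p⇒∣p∪⁅x⁆∣≡1+∣p∣ {p = p - x} (λ x∈p-x → proj₂ (x∈p-y⁻ {p = p} x∈p-x) refl) ⟩
  suc ∣ p - x ∣       ∎
  where open ≡-Reasoning

p⊆q∪⁅x⁆⇒p-x⊆q : ∀ {n} {p q : Subset n} {x : Fin n} → p ⊆ q ∪ ⁅ x ⁆ → p - x ⊆ q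
p⊆q∪⁅x⁆⇒p-x⊆q {q = q} {x} p⊆q∪⁅x⁆ y∈p-x with x∈p-y⁻ y∈p-x
... | y∈p , y≢x with x∈p∪q⁻ q ⁅ x ⁆ (p⊆q∪⁅x⁆ y∈p)
...   | inj₁ y∈q   = y∈q
...   | inj₂ y∈⁅x⁆ = contradiction (x∈⁅y⁆⇒x≡y x y∈⁅x⁆) y≢x

p⊆q∪⁅x⁆∧x∉p⇒p⊆q : ∀ {n} {p q : Subset n} {x : Fin n} → p ⊆ q ∪ ⁅ x ⁆ → x ∉ p → p ⊆ q
p⊆q∪⁅x⁆∧x∉p⇒p⊆q p⊆q∪⁅x⁆ x∉p y∈p =
  p⊆q∪⁅x⁆⇒p-x⊆q p⊆q∪⁅x⁆ (x∈p∧x≢y⇒x∈p-y y∈p λ { refl → x∉p y∈p })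

p⊆r∧x∈r⇒p∪⁅x⁆⊆r : ∀ {n} {p r : Subset n} {x : Fin n} → p ⊆ r → x ∈ r → p ∪ ⁅ x ⁆ ⊆ r
p⊆r∧x∈r⇒p∪⁅x⁆⊆r {p = p} {x = x} p⊆r x∈r y∈ with x∈p∪q⁻ p ⁅ x ⁆ y∈
... | inj₁ y∈p   = p⊆r y∈p
... | inj₂ y∈⁅x⁆ = subst (_∈ _) (sym (x∈⁅y⁆⇒x≡y x y∈⁅x⁆)) x∈r

∣q∣<∣p∣⇒Nonempty[p─q] : ∀ {n} {p q : Subset n} → ∣ q ∣ < ∣ p ∣ → Nonempty (p ─ q)
∣q∣<∣p∣⇒Nonempty[p─q] {p = p} {q} ∣q∣<∣p∣ with nonempty? (p ─ q)
... | yes nonempty = nonempty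
... | no  empty    = contradiction (p⊆q⇒∣p∣≤∣q∣ p⊆q) (<⇒≱ ∣q∣<∣p∣)
  where
  p⊆q : p ⊆ q
  p⊆q {x} x∈p with x ∈? q
  ... | yes x∈q = x∈q
  ... | no  x∉q = contradiction (x , x∈p∧x∉q⇒x∈p─q x∈p x∉q) empty

∣p∣>0⇒Nonempty : ∀ {n} {p : Subset n} → 0 < ∣ p ∣ → Nonempty p
∣p∣>0⇒Nonempty {n} {p} 0<∣p∣ =
  subst Nonempty (p─⊥≡p p) (∣q∣<∣p∣⇒Nonempty[p─q] (subst (_< ∣ p ∣) (sym (∣⊥∣≡0 n)) 0<∣p∣))

∣⋃ps∣≤length*b : ∀ {n} b (ps : List (Subset n)) → All (λ p → ∣ p ∣ ≤ b) ps → ∣ ⋃ ps ∣ ≤ length ps * b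
∣⋃ps∣≤length*b {n} b []       []         = ≤-reflexive (∣⊥∣≡0 n)
∣⋃ps∣≤length*b     b (p ∷ ps) (∣p∣≤b ∷ h) =
  ≤-trans (∣p∪q∣≤∣p∣+∣q∣ p (⋃ ps)) (+-mono-≤ ∣p∣≤b (∣⋃ps∣≤length*b b ps h))

p∈ps⇒p⊆⋃ps : ∀ {n} {p : Subset n} {ps : List (Subset n)} → p ∈ₗ ps → p ⊆ ⋃ ps
p∈ps⇒p⊆⋃ps {ps = p ∷ ps} (here refl) = p⊆p∪q (⋃ ps)
p∈ps⇒p⊆⋃ps {ps = q ∷ ps} (there p∈ps) = q⊆p∪q q (⋃ ps) ∘ p∈ps⇒p⊆⋃ps p∈ps

subsetsOfSize : ∀ {n} → ℕ → Subset n → List (Subset n)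
subsetsOfSize zero    _           = [ ⊥ ]
subsetsOfSize (suc t) []          = []
subsetsOfSize (suc t) (false ∷ K) = map (false ∷_) (subsetsOfSize (suc t) K)
subsetsOfSize (suc t) (true ∷ K)  =
  map (false ∷_) (subsetsOfSize (suc t) K) ++ map (true ∷_) (subsetsOfSize t K)

length-subsetsOfSize : ∀ {n} t (K : Subset n) → length (subsetsOfSize t K) ≤ ∣ K ∣ ^ t
length-subsetsOfSize zero    _           = ≤-refl
length-subsetsOfSize (suc t) []          = z≤n
length-subsetsOfSize (suc t) (false ∷ K) =
  ≤-trans (≤-reflexive (length-map (false ∷_) (subsetsOfSize (suc t) K))) (length-subsetsOfSize (suc t) K)
length-subsetsOfSize (suc t) (true ∷ K)  = begin
  length (map (false ∷_) Qs₁ ++ map (true ∷_) Qs₀) ≡⟨ length-++ (map (false ∷_) Qs₁) ⟩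
  length (map (false ∷_) Qs₁) + length (map (true ∷_) Qs₀)
    ≡⟨ cong₂ _+_ (length-map (false ∷_) Qs₁) (length-map (true ∷_) Qs₀) ⟩
  length Qs₁ + length Qs₀
    ≤⟨ +-mono-≤ (length-subsetsOfSize (suc t) K) (length-subsetsOfSize t K) ⟩
  ∣ K ∣ * ∣ K ∣ ^ t + ∣ K ∣ ^ t
    ≤⟨ +-mono-≤ (*-monoʳ-≤ ∣ K ∣ (^-monoˡ-≤ t (n≤1+n ∣ K ∣))) (^-monoˡ-≤ t (n≤1+n ∣ K ∣)) ⟩
  ∣ K ∣ * suc ∣ K ∣ ^ t + suc ∣ K ∣ ^ t ≡⟨ +-comm (∣ K ∣ * suc ∣ K ∣ ^ t) _ ⟩
  suc ∣ K ∣ ^ suc t ∎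
  where
  open ≤-Reasoning
  Qs₁ = subsetsOfSize (suc t) K
  Qs₀ = subsetsOfSize t K

∈-subsetsOfSize⁻ : ∀ {n} t {K Q : Subset n} → Q ∈ₗ subsetsOfSize t K → Q ⊆ K × ∣ Q ∣ ≡ t
∈-subsetsOfSize⁻ {n} zero (here refl) = ⊥⊆ , ∣⊥∣≡0 n
∈-subsetsOfSize⁻ (suc t) {false ∷ K} Q∈ with ∈-map⁻ (false ∷_) Q∈
... | Q , Q∈′ , refl with ∈-subsetsOfSize⁻ (suc t) Q∈′
...   | Q⊆K , ∣Q∣≡t = out⊆ Q⊆K , ∣Q∣≡t
∈-subsetsOfSize⁻ (suc t) {true ∷ K} Q∈ with ∈-++⁻ (map (false ∷_) (subsetsOfSize (suc t) K)) Q∈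
... | inj₁ Q∈₁ with ∈-map⁻ (false ∷_) Q∈₁
...   | Q , Q∈′ , refl with ∈-subsetsOfSize⁻ (suc t) Q∈′
...     | Q⊆K , ∣Q∣≡t = out⊆ Q⊆K , ∣Q∣≡t
∈-subsetsOfSize⁻ (suc t) {true ∷ K} Q∈ | inj₂ Q∈₀ with ∈-map⁻ (true ∷_) Q∈₀
...   | Q , Q∈′ , refl with ∈-subsetsOfSize⁻ t Q∈′
...     | Q⊆K , ∣Q∣≡t = in⊆in Q⊆K , cong suc ∣Q∣≡t

∣p∣≡0⇒p≡⊥ : ∀ {n} {p : Subset n} → ∣ p ∣ ≡ 0 → p ≡ ⊥
∣p∣≡0⇒p≡⊥ ∣p∣≡0 = Empty-unique λ (x , x∈p) → 1+n≢0 (trans (sym (x∈p⇒∣p∣≡1+∣p-x∣ x∈p)) ∣p∣≡0)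

∈-subsetsOfSize⁺ : ∀ {n} t {K Q : Subset n} → Q ⊆ K → ∣ Q ∣ ≡ t → Q ∈ₗ subsetsOfSize t K
∈-subsetsOfSize⁺ zero    _ ∣Q∣≡0 = here (∣p∣≡0⇒p≡⊥ ∣Q∣≡0)
∈-subsetsOfSize⁺ (suc t) {[]}        {[]}        _    ()
∈-subsetsOfSize⁺ (suc t) {false ∷ K} {false ∷ Q} Q⊆K ∣Q∣ =
  ∈-map⁺ (false ∷_) (∈-subsetsOfSize⁺ (suc t) (drop-∷-⊆ Q⊆K) ∣Q∣)
∈-subsetsOfSize⁺ (suc t) {false ∷ K} {true ∷ Q}  Q⊆K _   = contradiction (Q⊆K here) λ ()
∈-subsetsOfSize⁺ (suc t) {true ∷ K}  {false ∷ Q} Q⊆K ∣Q∣ =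
  ∈-++⁺ˡ (∈-map⁺ (false ∷_) (∈-subsetsOfSize⁺ (suc t) (drop-∷-⊆ Q⊆K) ∣Q∣))
∈-subsetsOfSize⁺ (suc t) {true ∷ K}  {true ∷ Q}  Q⊆K ∣Q∣ =
  ∈-++⁺ʳ _ (∈-map⁺ (true ∷_) (∈-subsetsOfSize⁺ t (drop-∷-⊆ Q⊆K) (suc-injective ∣Q∣)))

module _ {N : ℕ} (c : Colouring N) {e : ℕ} (2≤e : 2 ≤ e) where

  BlueIn : Subset N → Set
  BlueIn A = ∀ s → s ⊆ A → ∣ s ∣ ≡ suc e → c s ≡ blue

  BlueCliqueIn : ℕ → Subset N → Set
  BlueCliqueIn m W = Σ (Subset N) λ A → A ⊆ W × ∣ A ∣ ≡ m × BlueIn A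

  redLink : Subset N → Subset N
  redLink Q = tabulate λ v → c (Q ∪ ⁅ v ⁆)

  ∈-redLink⁺ : ∀ {Q v} → c (Q ∪ ⁅ v ⁆) ≡ red → v ∈ redLink Q
  ∈-redLink⁺ {Q} {v} isRed = lookup⇒[]= v (redLink Q) (trans (lookup∘tabulate _ v) isRed)

  ∈-redLink⁻ : ∀ {Q v} → v ∈ redLink Q → c (Q ∪ ⁅ v ⁆) ≡ red
  ∈-redLink⁻ {Q} {v} v∈ = trans (sym (lookup∘tabulate _ v)) ([]=⇒lookup v∈)

  RedEdgeFrom : Subset N → Fin N → Set
  RedEdgeFrom K u = ∃ λ T → T ⊆ K × ∣ T ∣ ≡ e × c (T ∪ ⁅ u ⁆) ≡ red

  BlueIn⊎RedEdge : ∀ A → BlueIn A ⊎ ∃ λ s → s ⊆ A × ∣ s ∣ ≡ suc e × c s ≡ red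
  BlueIn⊎RedEdge A with anySubset? (λ s → (s ⊆? A) ×-dec (∣ s ∣ ≟ suc e) ×-dec (c s Bool.≟ red))
  ... | yes redEdge   = inj₂ redEdge
  ... | no  noRedEdge = inj₁ blueA
    where
    blueA : BlueIn A
    blueA s s⊆A ∣s∣ with c s in cs
    ... | true  = contradiction (s , (λ {x} → s⊆A) , ∣s∣ , cs) noRedEdge
    ... | false = refl

  BlueIn-∪⁅⁆⊎RedEdgeFrom : ∀ {K} → BlueIn K → ∀ u → BlueIn (K ∪ ⁅ u ⁆) ⊎ RedEdgeFrom K u
  BlueIn-∪⁅⁆⊎RedEdgeFrom {K} blueK u with BlueIn⊎RedEdge (K ∪ ⁅ u ⁆)
  ... | inj₁ blue∪ = inj₁ blue∪
  ... | inj₂ (s , s⊆K∪⁅u⁆ , ∣s∣ , isRed) with u ∈? s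
  ...   | no  u∉s = contradiction (trans (sym isRed) (blueK s (p⊆q∪⁅x⁆∧x∉p⇒p⊆q s⊆K∪⁅u⁆ u∉s) ∣s∣)) λ ()
  ...   | yes u∈s = inj₂ (s - u , p⊆q∪⁅x⁆⇒p-x⊆q s⊆K∪⁅u⁆ ,
                          suc-injective (trans (sym (x∈p⇒∣p∣≡1+∣p-x∣ u∈s)) ∣s∣) ,
                          trans (cong c (x∈p⇒p-x∪⁅x⁆≡p u∈s)) isRed)

  extendClique : ∀ {W K m v} → K ⊆ W → ∣ K ∣ ≡ m → BlueIn K → v ∈ W → v ∉ K →
                 BlueCliqueIn (suc m) W ⊎ RedEdgeFrom K v
  extendClique {v = v} K⊆W ∣K∣≡m blueK v∈W v∉K with BlueIn-∪⁅⁆⊎RedEdgeFrom blueK v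
  ... | inj₁ blue∪ =
    inj₁ (_ , p⊆r∧x∈r⇒p∪⁅x⁆⊆r K⊆W v∈W , trans (x∉p⇒∣p∪⁅x⁆∣≡1+∣p∣ v∉K) (cong suc ∣K∣≡m) , blue∪)
  ... | inj₂ redEdge = inj₂ redEdge

  emptyClique : ∀ W → BlueCliqueIn 0 W
  emptyClique W = ⊥ , ⊥⊆ , ∣⊥∣≡0 N , λ s s⊆⊥ ∣s∣ →
    contradiction (subst₂ _≤_ ∣s∣ (∣⊥∣≡0 N) (p⊆q⇒∣p∣≤∣q∣ s⊆⊥)) λ ()

  CliqueOrHalfGraph : ℕ → Set
  CliqueOrHalfGraph m = ∀ W → (m !) ^ e ≤ ∣ W ∣ → RedHalfGraph (suc e) N c ⊎ BlueCliqueIn m W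

  module Step {m} (ih : CliqueOrHalfGraph m) {W K : Subset N}
              (K⊆W : K ⊆ W) (∣K∣≡m : ∣ K ∣ ≡ m) (blueK : BlueIn K) where

    Y : Subset N → Subset N
    Y Q = (W ─ K) ∩ redLink Q

    Qs : List (Subset N)
    Qs = subsetsOfSize e K

    ∈Y⇒∈W─K : ∀ {Q v} → v ∈ Y Q → v ∈ W × v ∉ K
    ∈Y⇒∈W─K {Q} v∈YQ = x∈p─q⁻ W K (proj₁ (x∈p∩q⁻ (W ─ K) (redLink Q) v∈YQ))

    ∈Y⇒∈redLink : ∀ {Q v} → v ∈ Y Q → v ∈ redLink Q
    ∈Y⇒∈redLink {Q} v∈YQ = proj₂ (x∈p∩q⁻ (W ─ K) (redLink Q) v∈YQ)

    halfGraph : ∀ {Q T u} → Q ⊆ K → ∣ Q ∣ ≡ e → T ⊆ Y Q → ∣ T ∣ ≡ e → u ∈ Q → c (T ∪ ⁅ u ⁆) ≡ red →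
                RedHalfGraph (suc e) N c
    halfGraph {Q} {T} {u} Q⊆K ∣Q∣≡e T⊆YQ ∣T∣≡e u∈Q redTu =
      Q , T , (λ x x∈Q x∈T → proj₂ (∈Y⇒∈W─K (T⊆YQ x∈T)) (Q⊆K x∈Q)) , ∣Q∣≡e , ∣T∣≡e ,
      (λ v v∈T → ∈-redLink⁻ (∈Y⇒∈redLink (T⊆YQ v∈T))) , u , u∈Q , redTu

    largeLink : ∀ {Q} → Q ∈ₗ Qs → (m !) ^ e ≤ ∣ Y Q ∣ → RedHalfGraph (suc e) N c ⊎ BlueCliqueIn (suc m) W
    largeLink {Q} Q∈Qs big with ∈-subsetsOfSize⁻ e Q∈Qs | ih (Y Q) big
    ... | _ | inj₁ halfGraph = inj₁ halfGraph
    ... | Q⊆K , ∣Q∣≡e | inj₂ (K′ , K′⊆YQ , ∣K′∣≡m , blueK′)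
        with ∣p∣>0⇒Nonempty (subst (0 <_) (sym ∣Q∣≡e) (≤-trans (s≤s z≤n) 2≤e))
    ...   | u , u∈Q with extendClique (proj₁ ∘ ∈Y⇒∈W─K ∘ K′⊆YQ) ∣K′∣≡m blueK′ (K⊆W (Q⊆K u∈Q))
                                      (λ u∈K′ → proj₂ (∈Y⇒∈W─K (K′⊆YQ u∈K′)) (Q⊆K u∈Q))
    ...     | inj₁ clique = inj₂ clique
    ...     | inj₂ (T , T⊆K′ , ∣T∣≡e , redTu) = inj₁ (halfGraph Q⊆K ∣Q∣≡e (K′⊆YQ ∘ T⊆K′) ∣T∣≡e u∈Q redTu)

    B : Subset N
    B = ⋃ (map Y Qs)

    ∣B∣≤m^e*m!^e : All (λ Q → ∣ Y Q ∣ < (m !) ^ e) Qs → ∣ B ∣ ≤ m ^ e * (m !) ^ e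
    ∣B∣≤m^e*m!^e small = begin
      ∣ B ∣                           ≤⟨ ∣⋃ps∣≤length*b _ (map Y Qs) (map⁺ (All.map <⇒≤ small)) ⟩
      length (map Y Qs) * (m !) ^ e   ≡⟨ cong (_* (m !) ^ e) (length-map Y Qs) ⟩
      length Qs * (m !) ^ e
        ≤⟨ *-monoˡ-≤ _ (subst (λ k → length Qs ≤ k ^ e) ∣K∣≡m (length-subsetsOfSize e K)) ⟩
      m ^ e * (m !) ^ e               ∎
      where open ≤-Reasoning

    ∣K∪B∣<∣W∣ : All (λ Q → ∣ Y Q ∣ < (m !) ^ e) Qs → (suc m !) ^ e ≤ ∣ W ∣ → ∣ K ∪ B ∣ < ∣ W ∣
    ∣K∪B∣<∣W∣ small big = begin-strict
      ∣ K ∪ B ∣             ≤⟨ ∣p∪q∣≤∣p∣+∣q∣ K B ⟩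
      ∣ K ∣ + ∣ B ∣         ≤⟨ +-mono-≤ (≤-reflexive ∣K∣≡m) (∣B∣≤m^e*m!^e small) ⟩
      m + m ^ e * (m !) ^ e <⟨ m+m^e*m!^e<[1+m]!^e m e 2≤e ⟩
      (suc m !) ^ e         ≤⟨ big ⟩
      ∣ W ∣                 ∎
      where open ≤-Reasoning

    smallLinks : All (λ Q → ∣ Y Q ∣ < (m !) ^ e) Qs → (suc m !) ^ e ≤ ∣ W ∣ → BlueCliqueIn (suc m) W
    smallLinks small big with ∣q∣<∣p∣⇒Nonempty[p─q] (∣K∪B∣<∣W∣ small big)
    ... | v , v∈W─K∪B with x∈p─q⁻ W (K ∪ B) v∈W─K∪B
    ...   | v∈W , v∉K∪B with extendClique K⊆W ∣K∣≡m blueK v∈W (v∉K∪B ∘ p⊆p∪q B)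
    ...     | inj₁ clique = clique
    ...     | inj₂ (T , T⊆K , ∣T∣≡e , redTv) = contradiction (q⊆p∪q K B v∈B) v∉K∪B
      where
      v∈YT : v ∈ Y T
      v∈YT = x∈p∩q⁺ (x∈p∧x∉q⇒x∈p─q v∈W (v∉K∪B ∘ p⊆p∪q B) , ∈-redLink⁺ redTv)
      v∈B : v ∈ B
      v∈B = p∈ps⇒p⊆⋃ps (∈-map⁺ Y (∈-subsetsOfSize⁺ e T⊆K ∣T∣≡e)) v∈YT

    step : (suc m !) ^ e ≤ ∣ W ∣ → RedHalfGraph (suc e) N c ⊎ BlueCliqueIn (suc m) W
    step big with any? (λ Q → (m !) ^ e ≤? ∣ Y Q ∣) Qs
    ... | yes someLarge = let (_ , Q∈Qs , bigYQ) = find someLarge in largeLink Q∈Qs bigYQ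
    ... | no  noneLarge = inj₂ (smallLinks (All.map ≰⇒> (¬Any⇒All¬ Qs noneLarge)) big)

  cliqueOrHalfGraph : ∀ m → CliqueOrHalfGraph m
  cliqueOrHalfGraph zero    W _   = inj₂ (emptyClique W)
  cliqueOrHalfGraph (suc m) W big with cliqueOrHalfGraph m W (≤-trans (m!^e≤[1+m]!^e m e) big)
  ... | inj₁ halfGraph                 = inj₁ halfGraph
  ... | inj₂ (K , K⊆W , ∣K∣≡m , blueK) = Step.step (cliqueOrHalfGraph m) K⊆W ∣K∣≡m blueK big

arrows-factorial : ∀ e n → 2 ≤ e → Arrows (suc e) n ((n !) ^ e)
arrows-factorial e n 2≤e c with cliqueOrHalfGraph c 2≤e n ⊤ (≤-reflexive (sym (∣⊤∣≡n _)))
... | inj₁ halfGraph               = inj₁ halfGraph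
... | inj₂ (A , _ , ∣A∣≡n , blueA) = inj₂ (A , ∣A∣≡n , blueA)

theorem5 : (k n : ℕ) → 4 ≤ k → k ≤ n → RamseyHalfGraph≤ k n ((n !) ^ (k ∸ 1))
theorem5 zero    n () _
theorem5 (suc e) n (s≤s 3≤e) _ = (n !) ^ e , ≤-refl , arrows-factorial e n (≤-trans (n≤1+n 2) 3≤e)
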